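{- Let $s\unrhd t$ and $s'\unrhd t'$ be nominal abstraction formulas with $(s\unrhd t)\approx(s'\unrhd t')$. Then $s\unrhd t$ and $s'\unrhd t'$ have exactly the same solutions. In particular, $s\unrhd t$ holds if and only if $s'\unrhd t'$ holds.
   Context: Terms are simply typed $\lambda$-terms built from constants and variables, identified up to $\alpha\beta\eta$-conversion; there is a type $o$ of formulas. The constants are partitioned into a set $\mathcal{C}$ of nominal constants (infinitely many at each relevant type) and a set $\mathcal{K}$ of ordinary constants. $\mathrm{supp}(t)$ is the set of nominal constants occurring in $t$. A permutation of nominal constants is a type-preserving bijection $\pi:\mathcal{C}\to\mathcal{C}$ moving only finitely many elements; it acts on terms homomorphically, replacing each nominal constant $a$ by $\pi(a)$ and fixing other constants and variables. $B\approx B'$ iff $B$ $\lambda$-converts to $\pi.B'$ for some permutation $\pi$. Nominal abstraction: for $n\ge 0$, if $s$ has type $\tau_1\to\cdots\to\tau_n\to\tau$ and $t$ has type $\tau$, then $s\unrhd t$ is a formula (a binary predicate symbol, overloaded at each degree $n$). For distinct nominal constants $c_1,\dots,c_n$, $\lambda c_1\dots\lambda c_n.t$ denotes $\lambda y_1\dots\lambda y_n.t'$ where $t'$ is $t$ with each $c_i$ replaced by a fresh variable $y_i$. We say "$s\unrhd t$ holds" iff $s$ $\lambda$-converts to $\lambda c_1\dots\lambda c_n.t$ for some distinct nominal constants $c_1,\dots,c_n$. A substitution is a type-preserving map from variables to terms, the identity on all but finitely many variables; $\mathrm{supp}(\theta)$ is the set of nominal constants in its range. $B[\theta]$ denotes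 ordinary capture-avoiding application; $B\langle\theta\rangle=(\pi.B)[\theta]$ where $\pi$ is a permutation mapping $\mathrm{supp}(B)$ to nominal constants outside $\mathrm{supp}(\theta)$. A substitution $\theta$ is a solution to $s\unrhd t$ iff $(s\unrhd t)\langle\theta\rangle$ holds, where $\theta$ is applied to the formula $s\unrhd t$ as a whole (giving some $s''\unrhd t''$) and then $\unrhd$ is read as the relation above. -}

module Defs where

open import Data.Nat using (ℕ; zero; suc) renaming (_≟_ to _≟ℕ_)
open import Data.List using (List; []; _∷_; _++_)
open import Data.List.Membership.Propositional using (_∈_)
open import Data.List.Relation.Unary.Unique.Propositional using (Unique)
open import Data.Product using (Σ; _×_; _,_)
open import Data.Sum using (_⊎_)
open import Relation.Nullary using (¬_; Dec; yes; no)
open import Relation.Binary.PropositionalEquality using (_≡_; _≢_; refl)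

-- Simple types (o = type of formulas, ι k = further base types)

infixr 7 _⇒_
data Ty : Set where
  o   : Ty
  ι   : ℕ → Ty
  _⇒_ : Ty → Ty → Ty

_≟T_ : (A B : Ty) → Dec (A ≡ B)
o ≟T o = yes refl
o ≟T ι _ = no λ ()
o ≟T (_ ⇒ _) = no λ ()
ι _ ≟T o = no λ ()
ι m ≟T ι n with m ≟ℕ n
... | yes refl = yes refl
... | no m≢n = no λ { refl → m≢n refl }
ι _ ≟T (_ ⇒ _) = no λ ()
(_ ⇒ _) ≟T o = no λ ()
(_ ⇒ _) ≟T ι _ = no λ ()
(A ⇒ B) ≟T (C ⇒ D) with A ≟T C | B ≟T D
... | yes refl | yes refl = yes refl
... | no A≢C | _ = no λ { refl → A≢C refl }
... | yes _ | no B≢D = no λ { refl → B≢D refl }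

_⇛_ : List Ty → Ty → Ty
[] ⇛ τ = τ
(A ∷ ts) ⇛ τ = A ⇒ (ts ⇛ τ)

-- Intrinsically typed λ-terms (de Bruijn variables).
-- Nominal constants: nom A n (infinitely many at each type A);
-- ordinary constants: con A n.

Ctx : Set
Ctx = List Ty

data _∋_ : Ctx → Ty → Set where
  here  : ∀ {Γ A} → (A ∷ Γ) ∋ A
  there : ∀ {Γ A B} → Γ ∋ A → (B ∷ Γ) ∋ A

data Tm (Γ : Ctx) : Ty → Set where
  var : ∀ {A} → Γ ∋ A → Tm Γ A
  nom : (A : Ty) → ℕ → Tm Γ A
  con : (A : Ty) → ℕ → Tm Γ A
  app : ∀ {A B} → Tm Γ (A ⇒ B) → Tm Γ A → Tm Γ B
  lam : ∀ {A B} → Tm (A ∷ Γ) B → Tm Γ (A ⇒ B)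

Ren : Ctx → Ctx → Set
Ren Γ Δ = ∀ {A} → Γ ∋ A → Δ ∋ A

ext : ∀ {Γ Δ B} → Ren Γ Δ → Ren (B ∷ Γ) (B ∷ Δ)
ext ρ here = here
ext ρ (there x) = there (ρ x)

rename : ∀ {Γ Δ A} → Ren Γ Δ → Tm Γ A → Tm Δ A
rename ρ (var x) = var (ρ x)
rename ρ (nom A n) = nom A n
rename ρ (con A n) = con A n
rename ρ (app t u) = app (rename ρ t) (rename ρ u)
rename ρ (lam t) = lam (rename (ext ρ) t)

Sub : Ctx → Ctx → Set
Sub Γ Δ = ∀ {A} → Γ ∋ A → Tm Δ A

exts : ∀ {Γ Δ B} → Sub Γ Δ → Sub (B ∷ Γ) (B ∷ Δ)
exts σ here = var here
exts σ (there x) = rename there (σ x)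

subst : ∀ {Γ Δ A} → Sub Γ Δ → Tm Γ A → Tm Δ A
subst σ (var x) = σ x
subst σ (nom A n) = nom A n
subst σ (con A n) = con A n
subst σ (app t u) = app (subst σ t) (subst σ u)
subst σ (lam t) = lam (subst (exts σ) t)

sub₀ : ∀ {Γ A} → Tm Γ A → Sub (A ∷ Γ) Γ
sub₀ u here = u
sub₀ u (there x) = var x

_[_]₀ : ∀ {Γ A B} → Tm (A ∷ Γ) B → Tm Γ A → Tm Γ B
t [ u ]₀ = subst (sub₀ u) t

-- λ-conversion (αβη; α is built into de Bruijn syntax)

infix 4 _≡βη_
data _≡βη_ {Γ : Ctx} : ∀ {A} → Tm Γ A → Tm Γ A → Set where
  β     : ∀ {A B} (t : Tm (A ∷ Γ) B) (u : Tm Γ A) → app (lam t) u ≡βη t [ u ]₀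
  η     : ∀ {A B} (t : Tm Γ (A ⇒ B)) → lam (app (rename there t) (var here)) ≡βη t
  appC  : ∀ {A B} {t t' : Tm Γ (A ⇒ B)} {u u' : Tm Γ A} →
          t ≡βη t' → u ≡βη u' → app t u ≡βη app t' u'
  lamC  : ∀ {A B} {t t' : Tm (A ∷ Γ) B} → t ≡βη t' → lam t ≡βη lam t'
  rfl   : ∀ {A} {t : Tm Γ A} → t ≡βη t
  sym   : ∀ {A} {t u : Tm Γ A} → t ≡βη u → u ≡βη t
  trans : ∀ {A} {t u v : Tm Γ A} → t ≡βη u → u ≡βη v → t ≡βη v

record Perm : Set where
  field
    fun     : Ty → ℕ → ℕ
    inv     : Ty → ℕ → ℕ
    inv-fun : ∀ A n → inv A (fun A n) ≡ n
    fun-inv : ∀ A n → fun A (inv A n) ≡ n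
    finSupp : Σ (List (Ty × ℕ)) λ L → ∀ A n → fun A n ≢ n → (A , n) ∈ L
open Perm public

_·_ : ∀ {Γ A} → Perm → Tm Γ A → Tm Γ A
π · var x = var x
π · nom A n = nom A (fun π A n)
π · con A n = con A n
π · app t u = app (π · t) (π · u)
π · lam t = lam (π · t)

data Occ (A : Ty) (n : ℕ) {Γ : Ctx} : ∀ {B} → Tm Γ B → Set where
  occ-nom  : Occ A n (nom A n)
  occ-appl : ∀ {B C} {t : Tm Γ (B ⇒ C)} {u : Tm Γ B} → Occ A n t → Occ A n (app t u)
  occ-appr : ∀ {B C} {t : Tm Γ (B ⇒ C)} {u : Tm Γ B} → Occ A n u → Occ A n (app t u)
  occ-lam  : ∀ {B C} {t : Tm (B ∷ Γ) C} → Occ A n {B ∷ Γ} t → Occ A n (lam t)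

insVar : ∀ {Γ A B} (Δ : Ctx) → (Δ ++ Γ) ∋ B → (Δ ++ A ∷ Γ) ∋ B
insVar [] x = there x
insVar (C ∷ Δ) here = here
insVar (C ∷ Δ) (there x) = there (insVar Δ x)

hereAt : ∀ {Γ A} (Δ : Ctx) → (Δ ++ A ∷ Γ) ∋ A
hereAt [] = here
hereAt (C ∷ Δ) = there (hereAt Δ)

-- replace nom A c by the (new) variable at position |Δ|
absAt : ∀ {B} (Γ Δ : Ctx) (A : Ty) (c : ℕ) → Tm (Δ ++ Γ) B → Tm (Δ ++ A ∷ Γ) B
absAt Γ Δ A c (var x) = var (insVar Δ x)
absAt Γ Δ A c (nom B n) with B ≟T A | n ≟ℕ c
... | yes refl | yes _ = var (hereAt Δ)
... | yes _ | no _ = nom B n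
... | no _ | _ = nom B n
absAt Γ Δ A c (con B n) = con B n
absAt Γ Δ A c (app t u) = app (absAt Γ Δ A c t) (absAt Γ Δ A c u)
absAt Γ Δ A c (lam {A'} t) = lam (absAt Γ (A' ∷ Δ) A c t)

data Names : List Ty → Set where
  []  : Names []
  _∷_ : ∀ {A ts} → ℕ → Names ts → Names (A ∷ ts)

keys : ∀ {ts} → Names ts → List (Ty × ℕ)
keys [] = []
keys {A ∷ ts} (c ∷ cs) = (A , c) ∷ keys cs

Distinct : ∀ {ts} → Names ts → Set
Distinct cs = Unique (keys cs)

lamAbs : ∀ {Γ ts τ} → Names ts → Tm Γ τ → Tm Γ (ts ⇛ τ)
lamAbs [] t = t
lamAbs {Γ} {A ∷ ts} (c ∷ cs) t = lam (absAt Γ [] A c (lamAbs cs t))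

-- Nominal abstraction s ⊵ t of degree n = length ts, with
-- s : τ₁ → ⋯ → τₙ → τ and t : τ.

Holds : ∀ {Γ ts τ} → Tm Γ (ts ⇛ τ) → Tm Γ τ → Set
Holds {ts = ts} s t = Σ (Names ts) λ cs → Distinct cs × (s ≡βη lamAbs cs t)

Approx : ∀ {Γ ts τ} → Tm Γ (ts ⇛ τ) → Tm Γ τ → Tm Γ (ts ⇛ τ) → Tm Γ τ → Set
Approx s t s' t' = Σ Perm λ π → (s ≡βη π · s') × (t ≡βη π · t')

-- θ is a solution to s ⊵ t: (s ⊵ t)⟨θ⟩ = (π.(s ⊵ t))[θ] holds, for a
-- permutation π mapping supp(s ⊵ t) outside supp(θ)
Solution : ∀ {Γ Δ ts τ} → Sub Γ Δ → Tm Γ (ts ⇛ τ) → Tm Γ τ → Set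
Solution {Γ} θ s t =
  Σ Perm λ π →
    (∀ A n → (Occ A n s ⊎ Occ A n t) →
       ∀ {C} (x : Γ ∋ C) → ¬ Occ A (fun π A n) (θ x))
    × Holds (subst θ (π · s)) (subst θ (π · t))

-- λ-conversion is preserved by substitution, by the permutation action and
-- by abstraction over a nominal constant; all three are instances of one
-- simultaneous substitution for variables and nominal constants, so this is
-- proved once.  Nominal abstraction is moreover equivariant.
--
-- If s ≡βη π·s', then s' ≡βη π⁻¹·s and equivariance transports the witness
-- that s ⊵ t holds.  For a solution θ of s ⊵ t with renaming π₀, the
-- renaming π₀∘π makes (s' ⊵ t')[θ] hold up to conversion, but it need not
-- move supp(s', t') away from supp(θ): constants of s' erased by the
-- conversion s ≡βη π·s' are not controlled.  Swapping each offending atom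
-- with a fresh one repairs this without changing the renaming on supp(s, t).

module Submission where

open import Defs
open import Data.Empty using (⊥-elim)
open import Data.List using (List; []; _∷_; _++_; map)
open import Data.List.Extrema.Nat using (max; xs≤max)
open import Data.List.Membership.Propositional using (_∈_; _∉_)
open import Data.List.Membership.Propositional.Properties using (∈-map⁺; ∈-++⁺ˡ; ∈-++⁺ʳ; ∈-++⁻)
open import Data.List.Relation.Unary.All as All using ()
open import Data.List.Relation.Unary.Any using (here; there)
open import Data.List.Relation.Unary.Unique.Propositional using (Unique)
import Data.List.Relation.Unary.Unique.Propositional.Properties as Unique
open import Data.Nat using (ℕ; suc) renaming (_≟_ to _≟ℕ_)
open import Data.Nat.Properties using (n≮n)
open import Data.Product using (Σ; _×_; _,_; proj₁; proj₂)
open import Data.Product.Properties using (≡-dec)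
open import Data.Sum using (_⊎_; inj₁; inj₂)
import Data.Sum as Sum
open import Relation.Nullary using (Dec; yes; no)
import Relation.Binary.PropositionalEquality as Eq
open Eq using (_≡_; _≢_; refl; cong; cong₂)

ext-cong : ∀ {Γ Δ B} {ρ ρ' : Ren Γ Δ} → (∀ {A} (x : Γ ∋ A) → ρ x ≡ ρ' x) →
           ∀ {A} (x : (B ∷ Γ) ∋ A) → ext ρ x ≡ ext ρ' x
ext-cong h here = refl
ext-cong h (there x) = cong there (h x)

rename-cong : ∀ {Γ Δ A} {ρ ρ' : Ren Γ Δ} → (∀ {A} (x : Γ ∋ A) → ρ x ≡ ρ' x) →
              (t : Tm Γ A) → rename ρ t ≡ rename ρ' t
rename-cong h (var x) = cong var (h x)
rename-cong h (nom A n) = refl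
rename-cong h (con A n) = refl
rename-cong h (app t u) = cong₂ app (rename-cong h t) (rename-cong h u)
rename-cong h (lam t) = cong lam (rename-cong (ext-cong h) t)

rename-rename : ∀ {Γ Δ Θ A} (ρ₂ : Ren Δ Θ) (ρ₁ : Ren Γ Δ) (t : Tm Γ A) →
                rename ρ₂ (rename ρ₁ t) ≡ rename (λ x → ρ₂ (ρ₁ x)) t
rename-rename ρ₂ ρ₁ (var x) = refl
rename-rename ρ₂ ρ₁ (nom A n) = refl
rename-rename ρ₂ ρ₁ (con A n) = refl
rename-rename ρ₂ ρ₁ (app t u) = cong₂ app (rename-rename ρ₂ ρ₁ t) (rename-rename ρ₂ ρ₁ u)
rename-rename ρ₂ ρ₁ (lam t) = cong lam (Eq.trans (rename-rename (ext ρ₂) (ext ρ₁) t)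
  (rename-cong (λ { here → refl ; (there x) → refl }) t))

rename-ext-weaken : ∀ {Γ Δ A B} (ρ : Ren Γ Δ) (t : Tm Γ A) →
                    rename (ext {B = B} ρ) (rename there t) ≡ rename there (rename ρ t)
rename-ext-weaken ρ t = Eq.trans (rename-rename (ext ρ) there t) (Eq.sym (rename-rename there ρ t))

-- Simultaneous substitution for variables and nominal constants

NomSub : Ctx → Set
NomSub Δ = (A : Ty) → ℕ → Tm Δ A

weakenNom : ∀ {Δ B} → NomSub Δ → NomSub (B ∷ Δ)
weakenNom κ A n = rename there (κ A n)

gsubst : ∀ {Γ Δ A} → Sub Γ Δ → NomSub Δ → Tm Γ A → Tm Δ A
gsubst σ κ (var x) = σ x
gsubst σ κ (nom A n) = κ A n
gsubst σ κ (con A n) = con A n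
gsubst σ κ (app t u) = app (gsubst σ κ t) (gsubst σ κ u)
gsubst σ κ (lam t) = lam (gsubst (exts σ) (weakenNom κ) t)

gsubst-cong : ∀ {Γ Δ A} {σ σ' : Sub Γ Δ} {κ κ' : NomSub Δ} →
              (∀ {A} (x : Γ ∋ A) → σ x ≡ σ' x) → (∀ A n → κ A n ≡ κ' A n) →
              (t : Tm Γ A) → gsubst σ κ t ≡ gsubst σ' κ' t
gsubst-cong hσ hκ (var x) = hσ x
gsubst-cong hσ hκ (nom A n) = hκ A n
gsubst-cong hσ hκ (con A n) = refl
gsubst-cong hσ hκ (app t u) = cong₂ app (gsubst-cong hσ hκ t) (gsubst-cong hσ hκ u)
gsubst-cong hσ hκ (lam t) = cong lam (gsubst-cong
  (λ { here → refl ; (there x) → cong (rename there) (hσ x) })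
  (λ A n → cong (rename there) (hκ A n)) t)

rename-gsubst : ∀ {Γ Δ Θ A} (ρ : Ren Δ Θ) (σ : Sub Γ Δ) (κ : NomSub Δ) (t : Tm Γ A) →
                rename ρ (gsubst σ κ t) ≡ gsubst (λ x → rename ρ (σ x)) (λ A n → rename ρ (κ A n)) t
rename-gsubst ρ σ κ (var x) = refl
rename-gsubst ρ σ κ (nom A n) = refl
rename-gsubst ρ σ κ (con A n) = refl
rename-gsubst ρ σ κ (app t u) = cong₂ app (rename-gsubst ρ σ κ t) (rename-gsubst ρ σ κ u)
rename-gsubst ρ σ κ (lam t) = cong lam (Eq.trans (rename-gsubst (ext ρ) (exts σ) (weakenNom κ) t)
  (gsubst-cong (λ { here → refl ; (there x) → rename-ext-weaken ρ (σ x) })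
               (λ A n → rename-ext-weaken ρ (κ A n)) t))

gsubst-rename : ∀ {Γ Δ Θ A} (σ : Sub Δ Θ) (κ : NomSub Θ) (ρ : Ren Γ Δ) (t : Tm Γ A) →
                gsubst σ κ (rename ρ t) ≡ gsubst (λ x → σ (ρ x)) κ t
gsubst-rename σ κ ρ (var x) = refl
gsubst-rename σ κ ρ (nom A n) = refl
gsubst-rename σ κ ρ (con A n) = refl
gsubst-rename σ κ ρ (app t u) = cong₂ app (gsubst-rename σ κ ρ t) (gsubst-rename σ κ ρ u)
gsubst-rename σ κ ρ (lam t) = cong lam (Eq.trans (gsubst-rename (exts σ) (weakenNom κ) (ext ρ) t)
  (gsubst-cong (λ { here → refl ; (there x) → refl }) (λ A n → refl) t))

gsubst-weaken : ∀ {Γ Δ A B} (σ : Sub Γ Δ) (κ : NomSub Δ) (u : Tm Γ A) →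
                gsubst (exts {B = B} σ) (weakenNom κ) (rename there u) ≡ rename there (gsubst σ κ u)
gsubst-weaken σ κ u =
  Eq.trans (gsubst-rename (exts σ) (weakenNom κ) there u) (Eq.sym (rename-gsubst there σ κ u))

gsubst-gsubst : ∀ {Γ Δ Θ A} (σ₂ : Sub Δ Θ) (κ₂ : NomSub Θ) (σ₁ : Sub Γ Δ) (κ₁ : NomSub Δ)
                (t : Tm Γ A) →
                gsubst σ₂ κ₂ (gsubst σ₁ κ₁ t)
                  ≡ gsubst (λ x → gsubst σ₂ κ₂ (σ₁ x)) (λ A n → gsubst σ₂ κ₂ (κ₁ A n)) t
gsubst-gsubst σ₂ κ₂ σ₁ κ₁ (var x) = refl
gsubst-gsubst σ₂ κ₂ σ₁ κ₁ (nom A n) = refl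
gsubst-gsubst σ₂ κ₂ σ₁ κ₁ (con A n) = refl
gsubst-gsubst σ₂ κ₂ σ₁ κ₁ (app t u) =
  cong₂ app (gsubst-gsubst σ₂ κ₂ σ₁ κ₁ t) (gsubst-gsubst σ₂ κ₂ σ₁ κ₁ u)
gsubst-gsubst σ₂ κ₂ σ₁ κ₁ (lam t) = cong lam (Eq.trans
  (gsubst-gsubst (exts σ₂) (weakenNom κ₂) (exts σ₁) (weakenNom κ₁) t)
  (gsubst-cong (λ { here → refl ; (there x) → gsubst-weaken σ₂ κ₂ (σ₁ x) })
               (λ A n → gsubst-weaken σ₂ κ₂ (κ₁ A n)) t))

gsubst-id : ∀ {Γ A} {σ : Sub Γ Γ} {κ : NomSub Γ} → (∀ {A} (x : Γ ∋ A) → σ x ≡ var x) →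
            (∀ A n → κ A n ≡ nom A n) → (t : Tm Γ A) → gsubst σ κ t ≡ t
gsubst-id hσ hκ (var x) = hσ x
gsubst-id hσ hκ (nom A n) = hκ A n
gsubst-id hσ hκ (con A n) = refl
gsubst-id hσ hκ (app t u) = cong₂ app (gsubst-id hσ hκ t) (gsubst-id hσ hκ u)
gsubst-id hσ hκ (lam t) = cong lam (gsubst-id
  (λ { here → refl ; (there x) → cong (rename there) (hσ x) })
  (λ A n → cong (rename there) (hκ A n)) t)

subst-as-gsubst : ∀ {Γ Δ A} (σ : Sub Γ Δ) (t : Tm Γ A) → subst σ t ≡ gsubst σ nom t
subst-as-gsubst σ (var x) = refl
subst-as-gsubst σ (nom A n) = refl
subst-as-gsubst σ (con A n) = refl
subst-as-gsubst σ (app t u) = cong₂ app (subst-as-gsubst σ t) (subst-as-gsubst σ u)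
subst-as-gsubst σ (lam t) = cong lam (subst-as-gsubst (exts σ) t)

gsubst-[]₀ : ∀ {Γ Δ A B} (σ : Sub Γ Δ) (κ : NomSub Δ) (t : Tm (A ∷ Γ) B) (u : Tm Γ A) →
             gsubst σ κ (t [ u ]₀) ≡ gsubst (exts σ) (weakenNom κ) t [ gsubst σ κ u ]₀
gsubst-[]₀ σ κ t u = begin
  gsubst σ κ (subst (sub₀ u) t)
    ≡⟨ cong (gsubst σ κ) (subst-as-gsubst (sub₀ u) t) ⟩
  gsubst σ κ (gsubst (sub₀ u) nom t)
    ≡⟨ gsubst-gsubst σ κ (sub₀ u) nom t ⟩
  gsubst (λ x → gsubst σ κ (sub₀ u x)) κ t
    ≡⟨ gsubst-cong (λ { here → refl ; (there x) → instantiate-weakened (σ x) })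
                   (λ A n → instantiate-weakened (κ A n)) t ⟨
  gsubst (λ x → gsubst (sub₀ u') nom (exts σ x)) (λ A n → gsubst (sub₀ u') nom (weakenNom κ A n)) t
    ≡⟨ gsubst-gsubst (sub₀ u') nom (exts σ) (weakenNom κ) t ⟨
  gsubst (sub₀ u') nom (gsubst (exts σ) (weakenNom κ) t)
    ≡⟨ subst-as-gsubst (sub₀ u') (gsubst (exts σ) (weakenNom κ) t) ⟨
  subst (sub₀ u') (gsubst (exts σ) (weakenNom κ) t) ∎
  where
  open Eq.≡-Reasoning
  u' = gsubst σ κ u
  instantiate-weakened : ∀ {C} (v : Tm _ C) → gsubst (sub₀ u') nom (rename there v) ≡ v
  instantiate-weakened v =
    Eq.trans (gsubst-rename _ _ there v) (gsubst-id (λ x → refl) (λ A n → refl) v)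

≡⇒≡βη : ∀ {Γ A} {t u : Tm Γ A} → t ≡ u → t ≡βη u
≡⇒≡βη refl = rfl

gsubst-βη : ∀ {Γ Δ A} (σ : Sub Γ Δ) (κ : NomSub Δ) {t t' : Tm Γ A} →
            t ≡βη t' → gsubst σ κ t ≡βη gsubst σ κ t'
gsubst-βη σ κ (β t u) = trans (β _ _) (≡⇒≡βη (Eq.sym (gsubst-[]₀ σ κ t u)))
gsubst-βη σ κ (η t) = trans (≡⇒≡βη (cong (λ z → lam (app z (var here))) (gsubst-weaken σ κ t))) (η _)
gsubst-βη σ κ (appC p q) = appC (gsubst-βη σ κ p) (gsubst-βη σ κ q)
gsubst-βη σ κ (lamC p) = lamC (gsubst-βη (exts σ) (weakenNom κ) p)
gsubst-βη σ κ rfl = rfl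
gsubst-βη σ κ (sym p) = sym (gsubst-βη σ κ p)
gsubst-βη σ κ (trans p q) = trans (gsubst-βη σ κ p) (gsubst-βη σ κ q)

≡βη-resp-gsubst : ∀ {Γ Δ A} (f : Tm Γ A → Tm Δ A) (σ : Sub Γ Δ) (κ : NomSub Δ) →
                  (∀ t → f t ≡ gsubst σ κ t) → ∀ {t t'} → t ≡βη t' → f t ≡βη f t'
≡βη-resp-gsubst f σ κ f≡ {t} {t'} p =
  trans (≡⇒≡βη (f≡ t)) (trans (gsubst-βη σ κ p) (≡⇒≡βη (Eq.sym (f≡ t'))))

subst-βη : ∀ {Γ Δ A} (σ : Sub Γ Δ) {t t' : Tm Γ A} → t ≡βη t' → subst σ t ≡βη subst σ t'
subst-βη σ = ≡βη-resp-gsubst (subst σ) σ nom (subst-as-gsubst σ)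

permNom : ∀ {Δ} → Perm → NomSub Δ
permNom π A n = nom A (fun π A n)

·-as-gsubst : ∀ {Γ A} (π : Perm) (t : Tm Γ A) → π · t ≡ gsubst var (permNom π) t
·-as-gsubst π (var x) = refl
·-as-gsubst π (nom A n) = refl
·-as-gsubst π (con A n) = refl
·-as-gsubst π (app t u) = cong₂ app (·-as-gsubst π t) (·-as-gsubst π u)
·-as-gsubst π (lam t) = cong lam (Eq.trans (·-as-gsubst π t)
  (gsubst-cong (λ { here → refl ; (there x) → refl }) (λ A n → refl) t))

·-βη : ∀ {Γ A} (π : Perm) {t t' : Tm Γ A} → t ≡βη t' → π · t ≡βη π · t'
·-βη π = ≡βη-resp-gsubst (π ·_) var (permNom π) (·-as-gsubst π)

absNom : ∀ {Γ} (Δ : Ctx) (A : Ty) (c : ℕ) → NomSub (Δ ++ A ∷ Γ)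
absNom Δ A c B n with B ≟T A | n ≟ℕ c
... | yes refl | yes _ = var (hereAt Δ)
... | yes _ | no _ = nom B n
... | no _ | _ = nom B n

absAt-as-gsubst : ∀ {B} (Γ Δ : Ctx) (A : Ty) (c : ℕ) (t : Tm (Δ ++ Γ) B) →
                  absAt Γ Δ A c t ≡ gsubst (λ x → var (insVar Δ x)) (absNom Δ A c) t
absAt-as-gsubst Γ Δ A c (var x) = refl
absAt-as-gsubst Γ Δ A c (nom B n) with B ≟T A | n ≟ℕ c
... | yes refl | yes _ = refl
... | yes refl | no _ = refl
... | no _ | _ = refl
absAt-as-gsubst Γ Δ A c (con B n) = refl
absAt-as-gsubst Γ Δ A c (app t u) = cong₂ app (absAt-as-gsubst Γ Δ A c t) (absAt-as-gsubst Γ Δ A c u)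
absAt-as-gsubst Γ Δ A c (lam {A'} t) = cong lam (Eq.trans (absAt-as-gsubst Γ (A' ∷ Δ) A c t)
  (gsubst-cong (λ { here → refl ; (there x) → refl }) absNom-weaken t))
  where
  absNom-weaken : ∀ B n → absNom (A' ∷ Δ) A c B n ≡ weakenNom (absNom Δ A c) B n
  absNom-weaken B n with B ≟T A | n ≟ℕ c
  ... | yes refl | yes _ = refl
  ... | yes refl | no _ = refl
  ... | no _ | _ = refl

lamAbs-βη : ∀ {Γ ts τ} (cs : Names ts) {t t' : Tm Γ τ} → t ≡βη t' → lamAbs cs t ≡βη lamAbs cs t'
lamAbs-βη [] p = p
lamAbs-βη {Γ} {A ∷ ts} (c ∷ cs) p = lamC (≡βη-resp-gsubst (absAt Γ [] A c) _ _
  (absAt-as-gsubst Γ [] A c) (lamAbs-βη cs p))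

Holds-resp-≡βη : ∀ {Γ ts τ} {s s' : Tm Γ (ts ⇛ τ)} {t t' : Tm Γ τ} →
                 s ≡βη s' → t ≡βη t' → Holds s t → Holds s' t'
Holds-resp-≡βη s≡s' t≡t' (cs , distinct , s≡) =
  cs , distinct , trans (sym s≡s') (trans s≡ (lamAbs-βη cs t≡t'))

-- Permutations of atoms

Atom : Set
Atom = Ty × ℕ

_≟A_ : (a b : Atom) → Dec (a ≡ b)
_≟A_ = ≡-dec _≟T_ _≟ℕ_

act : Perm → Atom → Atom
act π (A , n) = A , fun π A n

fun-injective : (π : Perm) (A : Ty) {m n : ℕ} → fun π A m ≡ fun π A n → m ≡ n
fun-injective π A {m} {n} e =
  Eq.trans (Eq.sym (inv-fun π A m)) (Eq.trans (cong (inv π A) e) (inv-fun π A n))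

act-injective : (π : Perm) {a b : Atom} → act π a ≡ act π b → a ≡ b
act-injective π {A , m} {B , n} e with cong proj₁ e
... | refl = cong (A ,_) (fun-injective π A (cong proj₂ e))

absNom-equivariant : ∀ {Γ} (π : Perm) (Δ : Ctx) (A : Ty) (c : ℕ) (B : Ty) (n : ℕ) →
                     π · absNom {Γ} Δ A c B n ≡ absNom Δ A (fun π A c) B (fun π B n)
absNom-equivariant π Δ A c B n with (B , n) ≟A (A , c)
... | yes refl = Eq.trans (cong (π ·_) (hit c)) (Eq.sym (hit (fun π A c)))
  where
  hit : ∀ c → absNom Δ A c A c ≡ var (hereAt Δ)
  hit c with A ≟T A | c ≟ℕ c
  ... | yes refl | yes _ = refl
  ... | yes refl | no c≢c = ⊥-elim (c≢c refl)
  ... | no A≢A | _ = ⊥-elim (A≢A refl)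
... | no Bn≢Ac = Eq.trans (cong (π ·_) (miss c n Bn≢Ac))
                          (Eq.sym (miss (fun π A c) (fun π B n) (λ e → Bn≢Ac (act-injective π e))))
  where
  miss : ∀ c n → (B , n) ≢ (A , c) → absNom Δ A c B n ≡ nom B n
  miss c n ne with B ≟T A | n ≟ℕ c
  ... | yes refl | yes refl = ⊥-elim (ne refl)
  ... | yes refl | no _ = refl
  ... | no _ | _ = refl

absAt-equivariant : ∀ {B} (π : Perm) (Γ Δ : Ctx) (A : Ty) (c : ℕ) (t : Tm (Δ ++ Γ) B) →
                    π · absAt Γ Δ A c t ≡ absAt Γ Δ A (fun π A c) (π · t)
absAt-equivariant π Γ Δ A c (var x) = refl
absAt-equivariant π Γ Δ A c (nom B n) =
  Eq.trans (cong (π ·_) (absAt-as-gsubst Γ Δ A c (nom B n)))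
  (Eq.trans (absNom-equivariant π Δ A c B n)
            (Eq.sym (absAt-as-gsubst Γ Δ A (fun π A c) (nom B (fun π B n)))))
absAt-equivariant π Γ Δ A c (con B n) = refl
absAt-equivariant π Γ Δ A c (app t u) =
  cong₂ app (absAt-equivariant π Γ Δ A c t) (absAt-equivariant π Γ Δ A c u)
absAt-equivariant π Γ Δ A c (lam {A'} t) = cong lam (absAt-equivariant π Γ (A' ∷ Δ) A c t)

permNames : ∀ {ts} → Perm → Names ts → Names ts
permNames π [] = []
permNames {A ∷ ts} π (c ∷ cs) = fun π A c ∷ permNames π cs

keys-permNames : ∀ {ts} (π : Perm) (cs : Names ts) → keys (permNames π cs) ≡ map (act π) (keys cs)
keys-permNames π [] = refl
keys-permNames {A ∷ ts} π (c ∷ cs) = cong ((A , fun π A c) ∷_) (keys-permNames π cs)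

lamAbs-equivariant : ∀ {Γ ts τ} (π : Perm) (cs : Names ts) (t : Tm Γ τ) →
                     π · lamAbs cs t ≡ lamAbs (permNames π cs) (π · t)
lamAbs-equivariant π [] t = refl
lamAbs-equivariant {Γ} {A ∷ ts} π (c ∷ cs) t = cong lam
  (Eq.trans (absAt-equivariant π Γ [] A c (lamAbs cs t))
            (cong (absAt Γ [] A (fun π A c)) (lamAbs-equivariant π cs t)))

Holds-equivariant : ∀ {Γ ts τ} (π : Perm) {s : Tm Γ (ts ⇛ τ)} {t : Tm Γ τ} →
                    Holds s t → Holds (π · s) (π · t)
Holds-equivariant π {t = t} (cs , distinct , s≡) =
    permNames π cs
  , Eq.subst Unique (Eq.sym (keys-permNames π cs)) (Unique.map⁺ (act-injective π) distinct)
  , trans (·-βη π s≡) (≡⇒≡βη (lamAbs-equivariant π cs t))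

infixr 9 _∘ₚ_

_∘ₚ_ : Perm → Perm → Perm
π₁ ∘ₚ π₂ = record
  { fun = λ B n → fun π₁ B (fun π₂ B n)
  ; inv = λ B n → inv π₂ B (inv π₁ B n)
  ; inv-fun = λ B n → Eq.trans (cong (inv π₂ B) (inv-fun π₁ B (fun π₂ B n))) (inv-fun π₂ B n)
  ; fun-inv = λ B n → Eq.trans (cong (fun π₁ B) (fun-inv π₂ B (inv π₁ B n))) (fun-inv π₁ B n)
  ; finSupp = L₁ ++ L₂ , moved
  }
  where
  L₁ = proj₁ (finSupp π₁)
  L₂ = proj₁ (finSupp π₂)
  moved : ∀ B n → fun π₁ B (fun π₂ B n) ≢ n → (B , n) ∈ L₁ ++ L₂
  moved B n ne with fun π₂ B n ≟ℕ n
  ... | yes fixed₂ = ∈-++⁺ˡ (proj₂ (finSupp π₁) B n (λ e → ne (Eq.trans (cong (fun π₁ B) fixed₂) e)))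
  ... | no moved₂ = ∈-++⁺ʳ L₁ (proj₂ (finSupp π₂) B n moved₂)

infix 30 _⁻¹

_⁻¹ : Perm → Perm
π ⁻¹ = record
  { fun = inv π
  ; inv = fun π
  ; inv-fun = fun-inv π
  ; fun-inv = inv-fun π
  ; finSupp = map (act π) L , moved
  }
  where
  L = proj₁ (finSupp π)
  moved : ∀ B n → inv π B n ≢ n → (B , n) ∈ map (act π) L
  moved B n ne = Eq.subst (λ k → (B , k) ∈ map (act π) L) (fun-inv π B n)
    (∈-map⁺ (act π) (proj₂ (finSupp π) B (inv π B n)
      (λ e → ne (Eq.trans (Eq.sym e) (fun-inv π B n)))))

swapℕ : ℕ → ℕ → ℕ → ℕ
swapℕ a b k with k ≟ℕ a
... | yes _ = b
... | no _ with k ≟ℕ b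
...   | yes _ = a
...   | no _ = k

swapℕ-left : ∀ a b → swapℕ a b a ≡ b
swapℕ-left a b with a ≟ℕ a
... | yes _ = refl
... | no a≢a = ⊥-elim (a≢a refl)

swapℕ-right : ∀ a b → swapℕ a b b ≡ a
swapℕ-right a b with b ≟ℕ a
... | yes b≡a = b≡a
... | no _ with b ≟ℕ b
...   | yes _ = refl
...   | no b≢b = ⊥-elim (b≢b refl)

swapℕ-other : ∀ a b k → k ≢ a → k ≢ b → swapℕ a b k ≡ k
swapℕ-other a b k k≢a k≢b with k ≟ℕ a
... | yes k≡a = ⊥-elim (k≢a k≡a)
... | no _ with k ≟ℕ b
...   | yes k≡b = ⊥-elim (k≢b k≡b)
...   | no _ = refl

swapℕ-involutive : ∀ a b k → swapℕ a b (swapℕ a b k) ≡ k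
swapℕ-involutive a b k with k ≟ℕ a
... | yes refl = swapℕ-right k b
... | no k≢a with k ≟ℕ b
...   | yes refl = swapℕ-left a k
...   | no k≢b = swapℕ-other a b k k≢a k≢b

swapAt : Ty → ℕ → ℕ → Ty → ℕ → ℕ
swapAt A a b B k with B ≟T A
... | yes _ = swapℕ a b k
... | no _ = k

swapAt-involutive : ∀ A a b B k → swapAt A a b B (swapAt A a b B k) ≡ k
swapAt-involutive A a b B k with B ≟T A
... | yes _ = swapℕ-involutive a b k
... | no _ = refl

swapAt-left : ∀ A a b → swapAt A a b A a ≡ b
swapAt-left A a b with A ≟T A
... | yes _ = swapℕ-left a b
... | no A≢A = ⊥-elim (A≢A refl)

swapAt-other : ∀ A a b B k → (B , k) ≢ (A , a) → (B , k) ≢ (A , b) → swapAt A a b B k ≡ k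
swapAt-other A a b B k ≢a ≢b with B ≟T A
... | yes refl = swapℕ-other a b k (λ e → ≢a (cong (B ,_) e)) (λ e → ≢b (cong (B ,_) e))
... | no _ = refl

swapAt-moved : ∀ A a b B k → swapAt A a b B k ≢ k → (B , k) ∈ (A , a) ∷ (A , b) ∷ []
swapAt-moved A a b B k ne with (B , k) ≟A (A , a) | (B , k) ≟A (A , b)
... | yes e | _ = here e
... | no _ | yes e = there (here e)
... | no ≢a | no ≢b = ⊥-elim (ne (swapAt-other A a b B k ≢a ≢b))

transpose : Ty → ℕ → ℕ → Perm
transpose A a b = record
  { fun = swapAt A a b
  ; inv = swapAt A a b
  ; inv-fun = swapAt-involutive A a b
  ; fun-inv = swapAt-involutive A a b
  ; finSupp = _ , swapAt-moved A a b
  }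

-- Supports

occs : ∀ {Γ B} → Tm Γ B → List Atom
occs (var x) = []
occs (nom A n) = (A , n) ∷ []
occs (con A n) = []
occs (app t u) = occs t ++ occs u
occs (lam t) = occs t

Occ⇒∈occs : ∀ {Γ B A n} {t : Tm Γ B} → Occ A n t → (A , n) ∈ occs t
Occ⇒∈occs occ-nom = here refl
Occ⇒∈occs (occ-appl oc) = ∈-++⁺ˡ (Occ⇒∈occs oc)
Occ⇒∈occs {t = app t u} (occ-appr oc) = ∈-++⁺ʳ (occs t) (Occ⇒∈occs oc)
Occ⇒∈occs (occ-lam oc) = Occ⇒∈occs oc

∈occs⇒Occ : ∀ {Γ B A n} (t : Tm Γ B) → (A , n) ∈ occs t → Occ A n t
∈occs⇒Occ (nom A n) (here refl) = occ-nom
∈occs⇒Occ (app t u) p with ∈-++⁻ (occs t) p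
... | inj₁ q = occ-appl (∈occs⇒Occ t q)
... | inj₂ q = occ-appr (∈occs⇒Occ u q)
∈occs⇒Occ (lam t) p = occ-lam (∈occs⇒Occ t p)

suppSub : ∀ Γ {Δ} → Sub Γ Δ → List Atom
suppSub [] θ = []
suppSub (A ∷ Γ) θ = occs (θ here) ++ suppSub Γ (λ x → θ (there x))

Occ⇒∈suppSub : ∀ {Γ Δ C A n} (θ : Sub Γ Δ) (x : Γ ∋ C) → Occ A n (θ x) → (A , n) ∈ suppSub Γ θ
Occ⇒∈suppSub θ here oc = ∈-++⁺ˡ (Occ⇒∈occs oc)
Occ⇒∈suppSub {B ∷ Γ} θ (there x) oc =
  ∈-++⁺ʳ (occs (θ here)) (Occ⇒∈suppSub (λ y → θ (there y)) x oc)

∈suppSub⇒Occ : ∀ {Γ Δ A n} (θ : Sub Γ Δ) → (A , n) ∈ suppSub Γ θ →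
               Σ Ty λ C → Σ (Γ ∋ C) λ x → Occ A n (θ x)
∈suppSub⇒Occ {B ∷ Γ} θ p with ∈-++⁻ (occs (θ here)) p
... | inj₁ q = B , here , ∈occs⇒Occ (θ here) q
... | inj₂ q with ∈suppSub⇒Occ (λ y → θ (there y)) q
...   | C , x , oc = C , there x , oc

Occ₂⇒∈occs : ∀ {Γ B C A n} {s : Tm Γ B} {t : Tm Γ C} →
             Occ A n s ⊎ Occ A n t → (A , n) ∈ occs s ++ occs t
Occ₂⇒∈occs (inj₁ oc) = ∈-++⁺ˡ (Occ⇒∈occs oc)
Occ₂⇒∈occs {s = s} (inj₂ oc) = ∈-++⁺ʳ (occs s) (Occ⇒∈occs oc)

∈occs⇒Occ₂ : ∀ {Γ B C A n} (s : Tm Γ B) (t : Tm Γ C) →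
             (A , n) ∈ occs s ++ occs t → Occ A n s ⊎ Occ A n t
∈occs⇒Occ₂ s t p = Sum.map (∈occs⇒Occ s) (∈occs⇒Occ t) (∈-++⁻ (occs s) p)

∘ₚ-· : ∀ {Γ A} (π₁ π₂ : Perm) (t : Tm Γ A) → (π₁ ∘ₚ π₂) · t ≡ π₁ · (π₂ · t)
∘ₚ-· π₁ π₂ (var x) = refl
∘ₚ-· π₁ π₂ (nom A n) = refl
∘ₚ-· π₁ π₂ (con A n) = refl
∘ₚ-· π₁ π₂ (app t u) = cong₂ app (∘ₚ-· π₁ π₂ t) (∘ₚ-· π₁ π₂ u)
∘ₚ-· π₁ π₂ (lam t) = cong lam (∘ₚ-· π₁ π₂ t)

⁻¹-·-cancel : ∀ {Γ A} (π : Perm) (t : Tm Γ A) → π ⁻¹ · (π · t) ≡ t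
⁻¹-·-cancel π (var x) = refl
⁻¹-·-cancel π (nom A n) = cong (nom A) (inv-fun π A n)
⁻¹-·-cancel π (con A n) = refl
⁻¹-·-cancel π (app t u) = cong₂ app (⁻¹-·-cancel π t) (⁻¹-·-cancel π u)
⁻¹-·-cancel π (lam t) = cong lam (⁻¹-·-cancel π t)

·-cong-occs : ∀ {Γ A} (π₁ π₂ : Perm) (t : Tm Γ A) →
              (∀ {a} → a ∈ occs t → act π₁ a ≡ act π₂ a) → π₁ · t ≡ π₂ · t
·-cong-occs π₁ π₂ (var x) h = refl
·-cong-occs π₁ π₂ (nom A n) h = cong (nom A) (cong proj₂ (h (here refl)))
·-cong-occs π₁ π₂ (con A n) h = refl
·-cong-occs π₁ π₂ (app t u) h =
  cong₂ app (·-cong-occs π₁ π₂ t (λ p → h (∈-++⁺ˡ p))) (·-cong-occs π₁ π₂ u (λ p → h (∈-++⁺ʳ (occs t) p)))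
·-cong-occs π₁ π₂ (lam t) h = cong lam (·-cong-occs π₁ π₂ t h)

≡βη-·-flip : ∀ {Γ A} (π : Perm) {u u' : Tm Γ A} → u ≡βη π · u' → u' ≡βη π ⁻¹ · u
≡βη-·-flip π {u' = u'} p = sym (trans (·-βη (π ⁻¹) p) (≡⇒≡βη (⁻¹-·-cancel π u')))

≡βη-·-relabel : ∀ {Γ A} (π ρ π₀ : Perm) {u u' : Tm Γ A} → u ≡βη π · u' →
                (∀ {a} → a ∈ occs u → act ρ a ≡ act π₀ a) → π₀ · u ≡βη (ρ ∘ₚ π) · u'
≡βη-·-relabel π ρ π₀ {u} {u'} p ρ≈π₀ =
  trans (≡⇒≡βη (Eq.sym (·-cong-occs ρ π₀ u ρ≈π₀)))
        (trans (·-βη ρ p) (≡⇒≡βη (Eq.sym (∘ₚ-· ρ π u'))))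

fresh : List Atom → ℕ
fresh L = suc (max 0 (map proj₂ L))

fresh-∉ : ∀ A (L : List Atom) → (A , fresh L) ∉ L
fresh-∉ A L p = n≮n _ (All.lookup (xs≤max 0 (map proj₂ L)) (∈-map⁺ proj₂ p))

open import Data.List.Membership.DecPropositional _≟A_ using (_∈?_)

-- Each atom of L that lands in F is swapped with an atom fresh for F,
-- for the images of L, and for the images of P, so σ is unchanged on P.
avoid : (σ : Perm) (P F : List Atom) → (∀ {a} → a ∈ P → act σ a ∉ F) → (L : List Atom) →
        Σ Perm λ ρ → (∀ {a} → a ∈ P → act ρ a ≡ act σ a) × (∀ {a} → a ∈ L → act ρ a ∉ F)
avoid σ P F σ-avoids [] = σ , (λ _ → refl) , λ ()
avoid σ P F σ-avoids ((A , n) ∷ L) with avoid σ P F σ-avoids L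
... | ρ , ρ≈σ , ρ-avoids with act ρ (A , n) ∈? F
...   | no ∉F = ρ , ρ≈σ , λ { (here refl) → ∉F ; (there p) → ρ-avoids p }
...   | yes ∈F = τ ∘ₚ ρ , τρ≈σ , τρ-avoids
  where
  M : List Atom
  M = F ++ map (act ρ) L ++ map (act σ) P
  τ : Perm
  τ = transpose A (fun ρ A n) (fresh M)
  τ-fixes : ∀ {b} → b ∉ F → b ∈ M → act τ b ≡ b
  τ-fixes {B , k} b∉F b∈M = cong (B ,_) (swapAt-other A _ _ B k
    (λ e → b∉F (Eq.subst (_∈ F) (Eq.sym e) ∈F))
    (λ e → fresh-∉ A M (Eq.subst (_∈ M) e b∈M)))
  τρ≈σ : ∀ {a} → a ∈ P → act τ (act ρ a) ≡ act σ a
  τρ≈σ p = Eq.trans (cong (act τ) (ρ≈σ p))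
    (τ-fixes (σ-avoids p) (∈-++⁺ʳ F (∈-++⁺ʳ (map (act ρ) L) (∈-map⁺ (act σ) p))))
  τρ-avoids : ∀ {a} → a ∈ (A , n) ∷ L → act τ (act ρ a) ∉ F
  τρ-avoids (here refl) q =
    fresh-∉ A M (∈-++⁺ˡ (Eq.subst (λ k → (A , k) ∈ F) (swapAt-left A (fun ρ A n) (fresh M)) q))
  τρ-avoids (there p) =
    Eq.subst (_∉ F) (Eq.sym (τ-fixes (ρ-avoids p) (∈-++⁺ʳ F (∈-++⁺ˡ (∈-map⁺ (act ρ) p)))))
      (ρ-avoids p)

-- Transfer along ≈

Approx-sym : ∀ {Γ ts τ} {s s' : Tm Γ (ts ⇛ τ)} {t t' : Tm Γ τ} →
             Approx s t s' t' → Approx s' t' s t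
Approx-sym (π , s≈ , t≈) = π ⁻¹ , ≡βη-·-flip π s≈ , ≡βη-·-flip π t≈

Holds-transfer : ∀ {Γ ts τ} {s s' : Tm Γ (ts ⇛ τ)} {t t' : Tm Γ τ} →
                 Approx s t s' t' → Holds s t → Holds s' t'
Holds-transfer (π , s≈ , t≈) holds =
  Holds-resp-≡βη (sym (≡βη-·-flip π s≈)) (sym (≡βη-·-flip π t≈)) (Holds-equivariant (π ⁻¹) holds)

Solution-transfer : ∀ {Γ Δ ts τ} {s s' : Tm Γ (ts ⇛ τ)} {t t' : Tm Γ τ} (θ : Sub Γ Δ) →
                    Approx s t s' t' → Solution θ s t → Solution θ s' t'
Solution-transfer {Γ} {s = s} {s'} {t} {t'} θ (π , s≈ , t≈) (π₀ , π₀-fresh , holds)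
  with avoid π₀ (occs s ++ occs t) (suppSub Γ θ) π₀-avoids (map (act π) (occs s' ++ occs t'))
  where
  π₀-avoids : ∀ {a} → a ∈ occs s ++ occs t → act π₀ a ∉ suppSub Γ θ
  π₀-avoids {A , n} p q with ∈suppSub⇒Occ θ q
  ... | _ , x , oc = π₀-fresh A n (∈occs⇒Occ₂ s t p) x oc
... | ρ , ρ≈π₀ , ρ-avoids =
    ρ ∘ₚ π
  , (λ A n oc x oc' → ρ-avoids (∈-map⁺ (act π) (Occ₂⇒∈occs oc)) (Occ⇒∈suppSub θ x oc'))
  , Holds-resp-≡βη (relabel s≈ λ p → ρ≈π₀ (∈-++⁺ˡ p))
                   (relabel t≈ λ p → ρ≈π₀ (∈-++⁺ʳ (occs s) p)) holds
  where
  relabel : ∀ {B} {u u' : Tm Γ B} → u ≡βη π · u' → (∀ {a} → a ∈ occs u → act ρ a ≡ act π₀ a) →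
            subst θ (π₀ · u) ≡βη subst θ ((ρ ∘ₚ π) · u')
  relabel p ρ≈π₀ = subst-βη θ (≡βη-·-relabel π ρ π₀ p ρ≈π₀)

lemma2 : ∀ {Γ ts τ} (s s' : Tm Γ (ts ⇛ τ)) (t t' : Tm Γ τ) →
         Approx s t s' t' →
         (∀ {Δ} (θ : Sub Γ Δ) →
            (Solution θ s t → Solution θ s' t') × (Solution θ s' t' → Solution θ s t))
         × ((Holds s t → Holds s' t') × (Holds s' t' → Holds s t))
lemma2 s s' t t' s≈s' =
    (λ θ → Solution-transfer θ s≈s' , Solution-transfer θ (Approx-sym s≈s'))
  , Holds-transfer s≈s' , Holds-transfer (Approx-sym s≈s')
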